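{- Let $\mathcal{F}$ be the M-NAE version of a set $\mathcal{C}$ of 3-literal clauses, and let $S\subseteq U_3$. Then $S$ is the set of true variables of a standard truth assignment of $\mathcal{F}$ if and only if either $S$ is a feedback vertex set of $G^\triangleleft(\mathcal{F})$ or $S=U_3$.
   Context: The clauses. Let $X=\{x_1,\dots,x_n\}$ and let $\mathcal{C}=\{C_1,\dots,C_m\}$. Each clause involves three distinct variables and is written $C_r=(l_i\vee l_j\vee l_k)$ with $i<j<k$ and $l_u\in\{x_u,\overline{x_u}\}$. The variables. Let $U_2=\{y_1,\dots,y_n,w_1,\dots,w_m,z\}$ and $U_3=\{z\}\cup\bigcup_{g\in U_2\setminus\{z\}}\{\alpha_g,\beta_g,a_g,b_g,c_g\}$. The M-NAE version $\mathcal{F}$ is the following set of monotone clauses over $U_3$, with literal order as written: - for each $C_r=(l_i\vee l_j\vee l_k)$, the clauses $(\gamma_i\vee\gamma_j\vee\alpha_{w_r})$ and $(\beta_{w_r}\vee\gamma_k\vee z)$, where $\gamma_u=\alpha_{y_u}$ if $l_u=x_u$ and $\gamma_u=\beta_{y_u}$ if $l_u=\overline{x_u}$; - for each $g\in U_2\setminus\{z\}$, the clauses $(\alpha_g\vee\beta_g\vee a_g)$, $(\alpha_g\vee\beta_g\vee b_g)$, $(\alpha_g\vee\beta_g\vee c_g)$ and $(a_g\vee b_g\vee c_g)$. The representative graph $G^\triangleleft(\mathcal{F})$ has vertex set $U_3$ and an arc $uv$ iff some clause $(p\vee q\vee r)$ of $\mathcal{F}$ has $(u,v)\in\{(p,q),(q,r),(r,p)\}$.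 A standard truth assignment makes every clause contain a true literal. A feedback vertex set of a digraph $G=(V,E)$ is a set $S\subsetneq V$ meeting every directed cycle. -}

module Defs where

open import Data.Nat using (ℕ; suc; _<_)
open import Data.Fin using (Fin; zero; suc; toℕ; inject₁; fromℕ)
open import Data.Bool using (Bool; true; false; if_then_else_)
open import Data.Product using (Σ; ∃; _×_; _,_)
open import Data.Sum using (_⊎_)
open import Relation.Binary.PropositionalEquality using (_≡_)
open import Function.Definitions using (Injective)

-- A 3-literal clause over variables x_0..x_{n-1}: (l_i ∨ l_j ∨ l_k) with i<j<k.
-- The Bool sign is true iff the literal is the positive literal x_u.
record Clause (n : ℕ) : Set where
  field
    i j k : Fin n
    i<j   : toℕ i < toℕ j
    j<k   : toℕ j < toℕ k
    si sj sk : Bool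
open Clause public

-- U_2 \ {z} : the variables y_1..y_n, w_1..w_m.
data G (n m : ℕ) : Set where
  y : Fin n → G n m
  w : Fin m → G n m

-- U_3 = {z} ∪ ⋃_g {α_g, β_g, a_g, b_g, c_g}
data V (n m : ℕ) : Set where
  z : V n m
  α β a b c : G n m → V n m

γ : ∀ {n m} → Fin n → Bool → V n m
γ u s = if s then α (y u) else β (y u)

-- The clauses (p ∨ q ∨ r) of the M-NAE version F of C (literal order as written).
data InF {n m : ℕ} (C : Fin m → Clause n) : V n m → V n m → V n m → Set where
  cl₁ : ∀ r → InF C (γ (i (C r)) (si (C r))) (γ (j (C r)) (sj (C r))) (α (w r))
  cl₂ : ∀ r → InF C (β (w r)) (γ (k (C r)) (sk (C r))) z
  ga : ∀ g → InF C (α g) (β g) (a g)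
  gb : ∀ g → InF C (α g) (β g) (b g)
  gc : ∀ g → InF C (α g) (β g) (c g)
  gabc : ∀ g → InF C (a g) (b g) (c g)

Arc : ∀ {n m} → (Fin m → Clause n) → V n m → V n m → Set
Arc C u v = Σ _ λ p → Σ _ λ q → Σ _ λ r → InF C p q r ×
  (((u ≡ p) × (v ≡ q)) ⊎ ((u ≡ q) × (v ≡ r)) ⊎ ((u ≡ r) × (v ≡ p)))

record DirCycle {n m : ℕ} (C : Fin m → Clause n) : Set where
  field
    len  : ℕ
    vtx  : Fin (suc len) → V n m
    inj  : Injective _≡_ _≡_ vtx
    step : (t : Fin len) → Arc C (vtx (inject₁ t)) (vtx (suc t))
    back : Arc C (vtx (fromℕ len)) (vtx zero)
open DirCycle public

-- Subsets of U_3 are given by their (Bool-valued) characteristic function.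

StandardTruth : ∀ {n m} → (Fin m → Clause n) → (V n m → Bool) → Set
StandardTruth C S = ∀ p q r → InF C p q r → (S p ≡ true ⊎ S q ≡ true ⊎ S r ≡ true)

FVS : ∀ {n m} → (Fin m → Clause n) → (V n m → Bool) → Set
FVS C S = (∃ λ v → S v ≡ false) ×
          ((cyc : DirCycle C) → ∃ λ t → S (vtx cyc t) ≡ true)

module Submission where

-- (⇐) Every clause (p ∨ q ∨ r) of F is a directed triangle p → q → r → p of
--     G◁(F) on three distinct vertices, so a set meeting every directed cycle
--     contains a literal of every clause; the whole of U₃ trivially does too.
--
-- (⇒) Let S be standard and not all of U₃.  To show that S meets every cycle
--     we give a ranking of the vertices, with values in ℕ × ℕ ordered
--     lexicographically, which increases strictly along every arc whose two
--     ends are outside S.  A cycle avoiding S would then be a closed walk that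
--     strictly ascends in a strict order, which is impossible.  The ranking is
--     checked clause by clause: each clause is a triangle with at least one
--     vertex in S, so only arcs between its (at most two) other vertices count.

open import Defs
open import Data.Nat using (ℕ)
open import Data.Fin using (Fin)
open import Data.Bool using (Bool; true)
open import Data.Sum using (_⊎_)
open import Relation.Binary.PropositionalEquality using (_≡_)
open import Function.Bundles using (_⇔_)

open import Data.Nat using (zero; suc; _*_; _+_; _≤_; _<_; z≤n; s≤s; z<s)
open import Data.Nat.Properties
  using (≤-refl; ≤-trans; <⇒≤; n<1+n; <-irrefl; <-trans; <-asym; <-resp₂-≡;
         m≤n⇒m<n∨m≡n; *-monoʳ-≤; *-monoʳ-<; *-suc; +-monoʳ-<; module ≤-Reasoning)
open import Data.Fin using (zero; suc; toℕ; inject₁; fromℕ)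
open import Data.Fin.Properties using (toℕ<n; any?)
open import Data.Bool using (false; if_then_else_)
open import Data.Bool.Properties using (¬-not; if-cong) renaming (_≟_ to _≟ᵇ_)
open import Data.Product using (∃; _×_; _,_; proj₁; proj₂)
open import Data.Product.Relation.Binary.Lex.Strict using (×-Lex; ×-transitive; ×-asymmetric)
open import Data.Sum using (inj₁; inj₂; [_,_]′)
open import Data.Empty using (⊥-elim)
open import Function using (_∘_)
open import Relation.Binary.Core using (Rel)
open import Relation.Binary.Definitions using (Transitive; Asymmetric)
open import Relation.Binary.PropositionalEquality using (refl; sym; trans; cong; _≢_; isEquivalence)
open import Relation.Nullary using (¬_; Dec; yes; no)
open import Relation.Nullary.Decidable using (map′; _⊎-dec_)
open import Relation.Unary using (Pred; Decidable)
open import Function.Bundles using (mk⇔)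

module AscendingWalks {a ℓ} {A : Set a} {_<_ : Rel A ℓ}
                      (transitive : Transitive _<_) (asymmetric : Asymmetric _<_) where

  ascending : ∀ {len} (f : Fin (suc len) → A) →
              (∀ t → f (inject₁ t) < f (suc t)) → ∀ t → f zero < f (suc t)
  ascending f step zero    = step zero
  ascending f step (suc t) =
    transitive (ascending (f ∘ inject₁) (step ∘ inject₁) t) (step (suc t))

  noAscendingCycle : ∀ {len} (f : Fin (suc len) → A) →
                     (∀ t → f (inject₁ t) < f (suc t)) → ¬ (f (fromℕ len) < f zero)
  noAscendingCycle {zero}    f step back = asymmetric back back
  noAscendingCycle {suc len} f step back = asymmetric back (ascending f step (fromℕ len))

Rank : Set
Rank = ℕ × ℕ

_≺_ : Rel Rank _
_≺_ = ×-Lex _≡_ _<_ _<_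

≺-trans : Transitive _≺_
≺-trans = ×-transitive {_<₁_ = _<_} {_<₂_ = _<_} isEquivalence <-resp₂-≡ <-trans <-trans

≺-asym : Asymmetric _≺_
≺-asym = ×-asymmetric {_<₁_ = _<_} {_<₂_ = _<_} sym <-resp₂-≡ <-asym <-asym

majorStep : ∀ {M M′ μ μ′} → M < M′ → (M , μ) ≺ (M′ , μ′)
majorStep = inj₁

sameMajorStep : ∀ {M M′ μ μ′} → M ≡ M′ → μ < μ′ → (M , μ) ≺ (M′ , μ′)
sameMajorStep M≡M′ μ<μ′ = inj₂ (M≡M′ , μ<μ′)

minorStep : ∀ {M M′ μ μ′} → M ≤ M′ → μ < μ′ → (M , μ) ≺ (M′ , μ′)
minorStep M≤M′ μ<μ′ with m≤n⇒m<n∨m≡n M≤M′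
... | inj₁ M<M′ = majorStep M<M′
... | inj₂ M≡M′ = sameMajorStep M≡M′ μ<μ′

forcedFirst : ∀ {x y v : Bool} → x ≡ true ⊎ y ≡ true ⊎ v ≡ true →
              y ≡ false → v ≡ false → x ≡ true
forcedFirst (inj₁ x≡true)               _  _  = x≡true
forcedFirst (inj₂ (inj₁ refl))          () _
forcedFirst (inj₂ (inj₂ refl))          _  ()

forcedSecond : ∀ {x y v : Bool} → x ≡ true ⊎ y ≡ true ⊎ v ≡ true →
               x ≡ false → v ≡ false → y ≡ true
forcedSecond (inj₁ refl)                ()  _
forcedSecond (inj₂ (inj₁ y≡true))       _   _ = y≡true
forcedSecond (inj₂ (inj₂ refl))         _   ()

forcedThird : ∀ {x y v : Bool} → x ≡ true ⊎ y ≡ true ⊎ v ≡ true →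
              x ≡ false → y ≡ false → v ≡ true
forcedThird (inj₁ refl)                 ()  _
forcedThird (inj₂ (inj₁ refl))          _   ()
forcedThird (inj₂ (inj₂ v≡true))        _   _ = v≡true

module Triangles {n m : ℕ} (C : Fin m → Clause n) where

  γ-injective : ∀ {u u′ : Fin n} {s s′} → γ {n} {m} u s ≡ γ u′ s′ → u ≡ u′
  γ-injective {s = true}  {true}  refl = refl
  γ-injective {s = false} {false} refl = refl
  γ-injective {s = true}  {false} ()
  γ-injective {s = false} {true}  ()

  γ≢α-w : ∀ (u : Fin n) s (r : Fin m) → γ u s ≢ α (w r)
  γ≢α-w u true  r ()
  γ≢α-w u false r ()

  γ≢β-w : ∀ (u : Fin n) s (r : Fin m) → γ u s ≢ β (w r)
  γ≢β-w u true  r ()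
  γ≢β-w u false r ()

  γ≢z : ∀ (u : Fin n) s → γ {n} {m} u s ≢ z
  γ≢z u true  ()
  γ≢z u false ()

  clauseDistinct : ∀ {p q r} → InF C p q r → p ≢ q × q ≢ r × r ≢ p
  clauseDistinct (cl₁ r) =
    (λ e → <-irrefl (cong toℕ (γ-injective e)) (i<j (C r))) ,
    γ≢α-w _ _ r , (λ e → γ≢α-w _ _ r (sym e))
  clauseDistinct (cl₂ r)  = (λ e → γ≢β-w _ _ r (sym e)) , γ≢z _ _ , (λ ())
  clauseDistinct (ga g)   = (λ ()) , (λ ()) , (λ ())
  clauseDistinct (gb g)   = (λ ()) , (λ ()) , (λ ())
  clauseDistinct (gc g)   = (λ ()) , (λ ()) , (λ ())
  clauseDistinct (gabc g) = (λ ()) , (λ ()) , (λ ())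

  triangle : ∀ {p q r} → InF C p q r → DirCycle C
  triangle {p} {q} {r} cl = record
    { len = 2 ; vtx = corner ; inj = corner-injective ; step = arc
    ; back = p , q , r , cl , inj₂ (inj₂ (refl , refl)) }
    where
    corner : Fin 3 → V n m
    corner zero             = p
    corner (suc zero)       = q
    corner (suc (suc zero)) = r

    p≢q : p ≢ q
    p≢q = proj₁ (clauseDistinct cl)
    q≢r : q ≢ r
    q≢r = proj₁ (proj₂ (clauseDistinct cl))
    r≢p : r ≢ p
    r≢p = proj₂ (proj₂ (clauseDistinct cl))

    corner-injective : ∀ {t t′} → corner t ≡ corner t′ → t ≡ t′
    corner-injective {zero}             {zero}             _ = refl
    corner-injective {suc zero}         {suc zero}         _ = refl
    corner-injective {suc (suc zero)}   {suc (suc zero)}   _ = refl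
    corner-injective {zero}             {suc zero}         e = ⊥-elim (p≢q e)
    corner-injective {zero}             {suc (suc zero)}   e = ⊥-elim (r≢p (sym e))
    corner-injective {suc zero}         {zero}             e = ⊥-elim (p≢q (sym e))
    corner-injective {suc zero}         {suc (suc zero)}   e = ⊥-elim (q≢r e)
    corner-injective {suc (suc zero)}   {zero}             e = ⊥-elim (r≢p e)
    corner-injective {suc (suc zero)}   {suc zero}         e = ⊥-elim (q≢r (sym e))

    arc : (t : Fin 2) → Arc C (corner (inject₁ t)) (corner (suc t))
    arc zero       = p , q , r , cl , inj₁ (refl , refl)
    arc (suc zero) = p , q , r , cl , inj₂ (inj₁ (refl , refl))

  hittingSetIsStandard : (S : V n m → Bool) →
    ((cyc : DirCycle C) → ∃ λ t → S (vtx cyc t) ≡ true) → StandardTruth C S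
  hittingSetIsStandard S hits p q r cl with hits (triangle cl)
  ... | zero             , e = inj₁ e
  ... | suc zero         , e = inj₂ (inj₁ e)
  ... | suc (suc zero)   , e = inj₂ (inj₂ e)

gadgetVertex : ∀ {n m} → Fin 5 → G n m → V n m
gadgetVertex zero                         = α
gadgetVertex (suc zero)                   = β
gadgetVertex (suc (suc zero))             = a
gadgetVertex (suc (suc (suc zero)))       = b
gadgetVertex (suc (suc (suc (suc zero)))) = c

∃G? : ∀ {n m p} {P : Pred (G n m) p} → Decidable P → Dec (∃ P)
∃G? {P = P} P? =
  map′ [ (λ (u , Pu) → y u , Pu) , (λ (r , Pr) → w r , Pr) ]′ split
       (any? (P? ∘ y) ⊎-dec any? (P? ∘ w))
  where
  split : ∃ P → ∃ (P ∘ y) ⊎ ∃ (P ∘ w)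
  split (y u , Pu) = inj₁ (u , Pu)
  split (w r , Pr) = inj₂ (r , Pr)

∃V? : ∀ {n m p} {P : Pred (V n m) p} → Decidable P → Dec (∃ P)
∃V? {P = P} P? =
  map′ [ (λ Pz → z , Pz) , (λ (g , x , Pv) → gadgetVertex x g , Pv) ]′ split
       (P? z ⊎-dec ∃G? (λ g → any? (λ x → P? (gadgetVertex x g))))
  where
  split : ∃ P → P z ⊎ ∃ λ g → ∃ λ x → P (gadgetVertex x g)
  split (z   , Pv) = inj₁ Pv
  split (α g , Pv) = inj₂ (g , zero , Pv)
  split (β g , Pv) = inj₂ (g , suc zero , Pv)
  split (a g , Pv) = inj₂ (g , suc (suc zero) , Pv)
  split (b g , Pv) = inj₂ (g , suc (suc (suc zero)) , Pv)
  split (c g , Pv) = inj₂ (g , suc (suc (suc (suc zero))) , Pv)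

someFalseOrAllTrue : ∀ {n m} (S : V n m → Bool) →
                     (∃ λ v → S v ≡ false) ⊎ (∀ v → S v ≡ true)
someFalseOrAllTrue S with ∃V? (λ v → S v ≟ᵇ false)
... | yes someFalse = inj₁ someFalse
... | no  noneFalse = inj₂ (λ v → ¬-not (λ Sv≡false → noneFalse (v , Sv≡false)))

-- Major levels: variable i of C sits at level i, a clause just after its
-- middle variable, z above every variable, and the topmost value above z.
level : ℕ → ℕ
level i = suc (2 * i)

between : ℕ → ℕ
between i = suc (level i)

level-mono : ∀ {i k} → i < k → level i < level k
level-mono i<k = s≤s (*-monoʳ-< 2 i<k)

level<between : ∀ i → level i < between i
level<between i = n<1+n (level i)

between<level : ∀ {i k} → i < k → between i < level k
between<level {i} {k} i<k = s≤s (begin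
  2 + 2 * i ≡⟨ *-suc 2 i ⟨
  2 * suc i ≤⟨ *-monoʳ-≤ 2 i<k ⟩
  2 * k     ∎)
  where open ≤-Reasoning

between-mono : ∀ {i k} → i ≤ k → between i ≤ between k
between-mono i≤k = s≤s (s≤s (*-monoʳ-≤ 2 i≤k))

-- Position in a directed triangle x → y → v → x of a vertex, from the truth
-- values of its predecessor and of its predecessor's predecessor: the false
-- vertices are counted from just after a true one.
offset : Bool → Bool → ℕ
offset true  _     = 0
offset false true  = 1
offset false false = 2

offset<3 : ∀ s s′ → offset s s′ < 3
offset<3 true  _     = s≤s z≤n
offset<3 false true  = s≤s (s≤s z≤n)
offset<3 false false = s≤s (s≤s (s≤s z≤n))

-- Shifted by 2, offsets lie strictly between the minor ranks of β_g and α_g.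
1<2+offset : ∀ s s′ → 1 < 2 + offset s s′
1<2+offset _ _ = s≤s (s≤s z≤n)

2+offset<5 : ∀ s s′ → 2 + offset s s′ < 5
2+offset<5 s s′ = +-monoʳ-< 2 (offset<3 s s′)

offset-step : ∀ {sx sy sv} → sv ≡ true → sx ≡ false → offset sv sy < offset sx sv
offset-step refl refl = s≤s z≤n

module Ranking {n m : ℕ} (C : Fin m → Clause n) (S : V n m → Bool) where

  γi γj γk : Fin m → V n m
  γi r = γ (i (C r)) (si (C r))
  γj r = γ (j (C r)) (sj (C r))
  γk r = γ (k (C r)) (sk (C r))

  majorα majorβ majorGadget : G n m → ℕ
  majorα (y u) = level (toℕ u)
  majorα (w r) = if S (γj r) then 0 else between (toℕ (j (C r)))
  majorβ (y u) = level (toℕ u)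
  majorβ (w r) = if S z then majorα (w r) else between n
  majorGadget g = if S (α g) then majorβ g else majorα g

  major : V n m → ℕ
  major z     = level n
  major (α g) = majorα g
  major (β g) = majorβ g
  major (a g) = majorGadget g
  major (b g) = majorGadget g
  major (c g) = majorGadget g

  minor : V n m → ℕ
  minor z     = 0
  minor (α g) = if S (β g) then 5 else 0
  minor (β g) = 1
  minor (a g) = 2 + offset (S (c g)) (S (b g))
  minor (b g) = 2 + offset (S (a g)) (S (c g))
  minor (c g) = 2 + offset (S (b g)) (S (a g))

  rank : V n m → Rank
  rank v = major v , minor v

  γ-major : ∀ u s → major (γ u s) ≡ level (toℕ u)
  γ-major u true  = refl
  γ-major u false = refl

  majorα-w≤ : ∀ r → majorα (w r) ≤ between (toℕ (j (C r)))
  majorα-w≤ r with S (γj r)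
  ... | true  = z≤n
  ... | false = ≤-refl

  majorα≤majorβ : ∀ g → majorα g ≤ majorβ g
  majorα≤majorβ (y u) = ≤-refl
  majorα≤majorβ (w r) with S z
  ... | true  = ≤-refl
  ... | false = ≤-trans (majorα-w≤ r) (between-mono (<⇒≤ (toℕ<n (j (C r)))))

  Ordered : V n m → V n m → Set
  Ordered u v = S u ≡ false → S v ≡ false → rank u ≺ rank v

  TriangleRanked : V n m → V n m → V n m → Set
  TriangleRanked p q r = Ordered p q × Ordered q r × Ordered r p

  module _ (standard : StandardTruth C S) where
    open ≤-Reasoning

    clause₁Ranked : ∀ r → TriangleRanked (γi r) (γj r) (α (w r))
    clause₁Ranked r = i→j , j→w , w→i
      where
      i→j : Ordered (γi r) (γj r)
      i→j _ _ = majorStep (begin-strict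
        major (γi r)          ≡⟨ γ-major (i (C r)) (si (C r)) ⟩
        level (toℕ (i (C r))) <⟨ level-mono (i<j (C r)) ⟩
        level (toℕ (j (C r))) ≡⟨ γ-major (j (C r)) (sj (C r)) ⟨
        major (γj r)          ∎)
      j→w : Ordered (γj r) (α (w r))
      j→w j-false _ = majorStep (begin-strict
        major (γj r)            ≡⟨ γ-major (j (C r)) (sj (C r)) ⟩
        level (toℕ (j (C r)))   <⟨ level<between (toℕ (j (C r))) ⟩
        between (toℕ (j (C r))) ≡⟨ if-cong j-false ⟨
        majorα (w r)            ∎)
      w→i : Ordered (α (w r)) (γi r)
      w→i w-false i-false = majorStep (begin-strict
        majorα (w r)          ≡⟨ if-cong j-true ⟩
        0                     <⟨ z<s ⟩
        level (toℕ (i (C r))) ≡⟨ γ-major (i (C r)) (si (C r)) ⟨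
        major (γi r)          ∎)
        where
        j-true : S (γj r) ≡ true
        j-true = forcedSecond (standard _ _ _ (cl₁ r)) i-false w-false

    clause₂Ranked : ∀ r → TriangleRanked (β (w r)) (γk r) z
    clause₂Ranked r = w→k , k→z , z→w
      where
      w→k : Ordered (β (w r)) (γk r)
      w→k w-false k-false = majorStep (begin-strict
        majorβ (w r)            ≡⟨ if-cong z-true ⟩
        majorα (w r)            ≤⟨ majorα-w≤ r ⟩
        between (toℕ (j (C r))) <⟨ between<level (j<k (C r)) ⟩
        level (toℕ (k (C r)))   ≡⟨ γ-major (k (C r)) (sk (C r)) ⟨
        major (γk r)            ∎)
        where
        z-true : S z ≡ true
        z-true = forcedThird (standard _ _ _ (cl₂ r)) w-false k-false
      k→z : Ordered (γk r) z
      k→z _ _ = majorStep (begin-strict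
        major (γk r)          ≡⟨ γ-major (k (C r)) (sk (C r)) ⟩
        level (toℕ (k (C r))) <⟨ level-mono (toℕ<n (k (C r))) ⟩
        level n               ∎)
      z→w : Ordered z (β (w r))
      z→w z-false _ = majorStep (begin-strict
        level n      <⟨ level<between n ⟩
        between n    ≡⟨ if-cong z-false ⟨
        majorβ (w r) ∎)

    gadgetRanked : (x : G n m → V n m) → (∀ g → InF C (α g) (β g) (x g)) →
                   (∀ g → major (x g) ≡ majorGadget g) →
                   (∀ g → 1 < minor (x g)) → (∀ g → minor (x g) < 5) →
                   ∀ g → TriangleRanked (α g) (β g) (x g)
    gadgetRanked x clause major-x 1<minor minor<5 g = α→β , β→x , x→α
      where
      α→β : Ordered (α g) (β g)
      α→β _ β-false = minorStep (majorα≤majorβ g) (begin-strict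
        minor (α g) ≡⟨ if-cong β-false ⟩
        0           <⟨ z<s ⟩
        1           ∎)
      β→x : Ordered (β g) (x g)
      β→x β-false x-false = sameMajorStep (sym (trans (major-x g) (if-cong α-true))) (1<minor g)
        where
        α-true : S (α g) ≡ true
        α-true = forcedFirst (standard _ _ _ (clause g)) β-false x-false
      x→α : Ordered (x g) (α g)
      x→α x-false α-false = sameMajorStep (trans (major-x g) (if-cong α-false)) (begin-strict
        minor (x g) <⟨ minor<5 g ⟩
        5           ≡⟨ if-cong β-true ⟨
        minor (α g) ∎)
        where
        β-true : S (β g) ≡ true
        β-true = forcedSecond (standard _ _ _ (clause g)) α-false x-false

    abcRanked : ∀ g → TriangleRanked (a g) (b g) (c g)
    abcRanked g = a→b , b→c , c→a
      where
      satisfied : S (a g) ≡ true ⊎ S (b g) ≡ true ⊎ S (c g) ≡ true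
      satisfied = standard _ _ _ (gabc g)
      a→b : Ordered (a g) (b g)
      a→b a-false b-false =
        sameMajorStep refl (+-monoʳ-< 2 (offset-step (forcedThird satisfied a-false b-false) a-false))
      b→c : Ordered (b g) (c g)
      b→c b-false c-false =
        sameMajorStep refl (+-monoʳ-< 2 (offset-step (forcedFirst satisfied b-false c-false) b-false))
      c→a : Ordered (c g) (a g)
      c→a c-false a-false =
        sameMajorStep refl (+-monoʳ-< 2 (offset-step (forcedSecond satisfied a-false c-false) c-false))

    clauseRanked : ∀ {p q r} → InF C p q r → TriangleRanked p q r
    clauseRanked (cl₁ r)  = clause₁Ranked r
    clauseRanked (cl₂ r)  = clause₂Ranked r
    clauseRanked (ga g)   =
      gadgetRanked a ga (λ _ → refl) (λ _ → 1<2+offset _ _) (λ _ → 2+offset<5 _ _) g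
    clauseRanked (gb g)   =
      gadgetRanked b gb (λ _ → refl) (λ _ → 1<2+offset _ _) (λ _ → 2+offset<5 _ _) g
    clauseRanked (gc g)   =
      gadgetRanked c gc (λ _ → refl) (λ _ → 1<2+offset _ _) (λ _ → 2+offset<5 _ _) g
    clauseRanked (gabc g) = abcRanked g

    arcRanked : ∀ {u v} → Arc C u v → Ordered u v
    arcRanked (_ , _ , _ , cl , inj₁ (refl , refl))        = proj₁ (clauseRanked cl)
    arcRanked (_ , _ , _ , cl , inj₂ (inj₁ (refl , refl))) = proj₁ (proj₂ (clauseRanked cl))
    arcRanked (_ , _ , _ , cl , inj₂ (inj₂ (refl , refl))) = proj₂ (proj₂ (clauseRanked cl))

    everyCycleHit : (cyc : DirCycle C) → ∃ λ t → S (vtx cyc t) ≡ true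
    everyCycleHit cyc with any? (λ t → S (vtx cyc t) ≟ᵇ true)
    ... | yes hit = hit
    ... | no  miss = ⊥-elim (AscendingWalks.noAscendingCycle {_<_ = _≺_} ≺-trans ≺-asym
                               (rank ∘ vtx cyc)
                               (λ t → arcRanked (step cyc t) (false-at _) (false-at _))
                               (arcRanked (back cyc) (false-at _) (false-at _)))
      where
      false-at : ∀ t → S (vtx cyc t) ≡ false
      false-at t = ¬-not (λ e → miss (t , e))

claim3 : (n m : ℕ) (C : Fin m → Clause n) (S : V n m → Bool) →
    StandardTruth C S ⇔ (FVS C S ⊎ (∀ v → S v ≡ true))
claim3 n m C S = mk⇔ standard⇒ ⇒standard
  where
  standard⇒ : StandardTruth C S → FVS C S ⊎ (∀ v → S v ≡ true)
  standard⇒ standard =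
    [ (λ someFalse → inj₁ (someFalse , Ranking.everyCycleHit C S standard)) , inj₂ ]′
      (someFalseOrAllTrue S)

  ⇒standard : FVS C S ⊎ (∀ v → S v ≡ true) → StandardTruth C S
  ⇒standard (inj₁ (_ , hits)) = Triangles.hittingSetIsStandard C S hits
  ⇒standard (inj₂ allTrue) p q r _ = inj₁ (allTrue p)
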